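{- For $\mathbf{u}$ admissible, $\lambda(\mathbf{u})=0$ if and only if $\mathbf{u}$ is $p$-periodic for some $p\mid\gcd(M,N)$.
   Context: Let $M,N$ be positive integers and $I_{M,N}$ the set of subsets $\Delta\subset\mathbb{Z}_{\ge0}$ with $\Delta+N\subset\Delta$, $\Delta+M\subset\Delta$ and finite complement. For $\mathbf{u}=(u_0,\ldots,u_{N+M-1})\in\{0,1\}^{N+M}$, $I_{\mathbf{u}}=\{\Delta\in I_{M,N}:\ \forall\,0\le i<N+M,\ i\in\Delta\Leftrightarrow u_i=1\}$, and $\mathbf{u}$ is admissible if $I_{\mathbf{u}}\ne\emptyset$. $\lambda(\mathbf{u})=\sum_{i=0}^{M-1}(u_{i+N}-u_i)$. $\mathbf{u}$ is $p$-periodic if $\tilde u_i=\tilde u_{i+p}$ for all $i\in\mathbb{Z}$, where $\tilde u_{i+r(M+N)}:=u_i$ for $r\in\mathbb{Z}$, $0\le i<M+N$. -}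

module Defs where

open import Data.Nat as ℕ using (ℕ; zero; suc; _≤_)
open import Data.Nat.Properties using (m≤n+m)
open import Data.Integer as ℤ using (ℤ; +_; 0ℤ)
open import Data.Integer.DivMod using (_%ℕ_; n%ℕd<d)
open import Data.Fin using (Fin; zero; suc; toℕ; fromℕ<; inject≤; _↑ʳ_)
open import Data.Bool using (Bool; true; false)
open import Data.Product using (Σ; ∃; _×_)
open import Relation.Binary.PropositionalEquality using (_≡_)

-- Subsets of ℤ≥0 are represented by characteristic functions ℕ → Bool.
-- Δ ∈ I_{M,N}: Δ + N ⊆ Δ, Δ + M ⊆ Δ, and ℕ ∖ Δ is finite.
InI : (M N : ℕ) → (ℕ → Bool) → Set
InI M N Δ =
  (∀ n → Δ n ≡ true → Δ (n ℕ.+ N) ≡ true) ×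
  (∀ n → Δ n ≡ true → Δ (n ℕ.+ M) ≡ true) ×
  (∃ λ B → ∀ n → B ≤ n → Δ n ≡ true)

-- u ∈ {0,1}^{N+M} is a function Fin (N + M) → Bool (true = 1).
-- Δ ∈ I_u : for all 0 ≤ i < N+M, i ∈ Δ ⇔ u_i = 1.
InIu : (M N : ℕ) → (Fin (N ℕ.+ M) → Bool) → (ℕ → Bool) → Set
InIu M N u Δ = InI M N Δ × (∀ (i : Fin (N ℕ.+ M)) → Δ (toℕ i) ≡ u i)

Admissible : (M N : ℕ) → (Fin (N ℕ.+ M) → Bool) → Set
Admissible M N u = ∃ λ (Δ : ℕ → Bool) → InIu M N u Δ

bitℤ : Bool → ℤ
bitℤ true  = + 1
bitℤ false = + 0

sumℤ : (n : ℕ) → (Fin n → ℤ) → ℤ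
sumℤ zero    f = 0ℤ
sumℤ (suc n) f = f zero ℤ.+ sumℤ n (λ i → f (suc i))

-- λ(u) = Σ_{i=0}^{M-1} (u_{i+N} - u_i)
lam : (M N : ℕ) → (Fin (N ℕ.+ M) → Bool) → ℤ
lam M N u = sumℤ M (λ i → bitℤ (u (N ↑ʳ i)) ℤ.- bitℤ (u (inject≤ i (m≤n+m M N))))

-- periodic extension ũ : ℤ → Bool, ũ_{i + r L} = u_i  (L = length; L = 0 is a junk case)
ext : (L : ℕ) → (Fin L → Bool) → ℤ → Bool
ext zero    u i = false
ext (suc L) u i = u (fromℕ< (n%ℕd<d i (suc L)))

Periodic : (M N : ℕ) → ℕ → (Fin (N ℕ.+ M) → Bool) → Set
Periodic M N p u = ∀ (i : ℤ) → ext (N ℕ.+ M) u i ≡ ext (N ℕ.+ M) u (i ℤ.+ + p)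

module Submission where

-- Fix Δ ∈ I_u and read Δ as a 0/1 sequence. Then λ(u) = Σ_{n<M} (Δ(N+n) − Δ(n)), every
-- summand is ≥ 0 because Δ + N ⊆ Δ, and telescoping gives the same value for
-- Σ_{n<N} (Δ(M+n) − Δ(n)), whose summands are ≥ 0 because Δ + M ⊆ Δ. So λ(u) = 0 iff
-- Δ(N+n) = Δ(n) for n < M, iff moreover Δ(M+n) = Δ(n) for n < N. These two conditions say
-- that the cyclic word u is invariant under rotation by N and by M, hence (Bézout) by
-- gcd(M,N); conversely p-periodicity with p ∣ gcd(M,N) gives rotation invariance by N.

open import Defs
open import Data.Nat using (ℕ; NonZero; _+_)
open import Data.Nat.GCD using (gcd)
open import Data.Nat.Divisibility using (_∣_)
open import Data.Integer using (0ℤ)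
open import Data.Fin using (Fin)
open import Data.Bool using (Bool)
open import Data.Product using (∃; _×_)
open import Function.Bundles using (_⇔_)
open import Relation.Binary.PropositionalEquality using (_≡_)

open import Data.Bool using (true; false)
open import Data.Fin as Fin using (toℕ; fromℕ<; inject≤; _↑ʳ_)
open import Data.Fin.Properties using (toℕ-↑ʳ; toℕ-inject≤; fromℕ<-cong; toℕ-fromℕ<)
open import Data.Integer as ℤ using (ℤ; +_; _⊖_; ∣_∣; +≤+)
open import Data.Integer.DivMod using (_%ℕ_; _/ℕ_; n%ℕd<d; a≡a%ℕn+[a/ℕn]*n)
import Data.Integer.Properties as ℤ
open import Data.Integer.Tactic.RingSolver using (solve-∀)
open import Data.Nat as ℕ using (zero; suc; _*_; _<_; _<?_; _⊔_)
import Data.Nat.Properties as ℕ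
open import Data.Nat.DivMod using (m<n⇒m%n≡m)
open import Data.Nat.Divisibility using (divides; ∣-refl; ∣-trans)
open import Data.Nat.GCD using (gcd-GCD; gcd[m,n]∣n; module Bézout)
open import Data.Product using (_,_)
open import Function.Base using (_∘_)
open import Function.Bundles using (mk⇔; Equivalence)
open import Relation.Binary.PropositionalEquality
  using (refl; sym; trans; cong; cong₂; subst; module ≡-Reasoning)
open import Relation.Nullary using (yes; no)

residue-unique : ∀ {d r r′} (q q′ : ℤ) → r < d → r′ < d →
                 + r ℤ.+ q ℤ.* + d ≡ + r′ ℤ.+ q′ ℤ.* + d → r ≡ r′
residue-unique {d} {r} {r′} q q′ r<d r′<d eq = ℤ.+-injective (ℤ.i-j≡0⇒i≡j (+ r) (+ r′) r-r′≡0)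
  where
  difference : + r ℤ.- + r′ ≡ (q′ ℤ.- q) ℤ.* + d
  difference = begin
    + r ℤ.- + r′                                    ≡⟨ rearrange (+ r) (+ r′) q (+ d) ⟩
    (+ r ℤ.+ q ℤ.* + d) ℤ.- (+ r′ ℤ.+ q ℤ.* + d)    ≡⟨ cong (ℤ._- (+ r′ ℤ.+ q ℤ.* + d)) eq ⟩
    (+ r′ ℤ.+ q′ ℤ.* + d) ℤ.- (+ r′ ℤ.+ q ℤ.* + d)  ≡⟨ collect (+ r′) q q′ (+ d) ⟩
    (q′ ℤ.- q) ℤ.* + d                              ∎
    where
    open ≡-Reasoning
    rearrange : ∀ x y a n → x ℤ.- y ≡ (x ℤ.+ a ℤ.* n) ℤ.- (y ℤ.+ a ℤ.* n)
    rearrange = solve-∀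
    collect : ∀ y a b n → (y ℤ.+ b ℤ.* n) ℤ.- (y ℤ.+ a ℤ.* n) ≡ (b ℤ.- a) ℤ.* n
    collect = solve-∀

  ∣q′-q∣≡0 : ∣ q′ ℤ.- q ∣ ≡ 0
  ∣q′-q∣≡0 = ℕ.n<1⇒n≡0 (ℕ.*-cancelʳ-< d _ 1 (begin-strict
    ∣ q′ ℤ.- q ∣ * d        ≡⟨ ℤ.abs-* (q′ ℤ.- q) (+ d) ⟨
    ∣ (q′ ℤ.- q) ℤ.* + d ∣  ≡⟨ cong ∣_∣ difference ⟨
    ∣ + r ℤ.- + r′ ∣        ≡⟨ cong ∣_∣ (ℤ.[+m]-[+n]≡m⊖n r r′) ⟩
    ∣ r ⊖ r′ ∣              ≤⟨ ℤ.∣m⊝n∣≤m⊔n r r′ ⟩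
    r ⊔ r′                  <⟨ ℕ.⊔-lub r<d r′<d ⟩
    d                       ≡⟨ ℕ.*-identityˡ d ⟨
    1 * d                   ∎))
    where open ℕ.≤-Reasoning

  r-r′≡0 : + r ℤ.- + r′ ≡ 0ℤ
  r-r′≡0 = begin
    + r ℤ.- + r′        ≡⟨ difference ⟩
    (q′ ℤ.- q) ℤ.* + d  ≡⟨ cong (ℤ._* + d) (ℤ.∣i∣≡0⇒i≡0 {q′ ℤ.- q} ∣q′-q∣≡0) ⟩
    0ℤ ℤ.* + d          ≡⟨ ℤ.*-zeroˡ (+ d) ⟩
    0ℤ                  ∎
    where open ≡-Reasoning

%ℕ-unique : ∀ i {d r} .{{_ : NonZero d}} (q : ℤ) → r < d →
            i ≡ + r ℤ.+ q ℤ.* + d → i %ℕ d ≡ r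
%ℕ-unique i {d} q r<d i≡r+qd =
  residue-unique (i /ℕ d) q (n%ℕd<d i d) r<d (trans (sym (a≡a%ℕn+[a/ℕn]*n i d)) i≡r+qd)

[i+q*d]%ℕd≡i%ℕd : ∀ i q d .{{_ : NonZero d}} → (i ℤ.+ q ℤ.* + d) %ℕ d ≡ i %ℕ d
[i+q*d]%ℕd≡i%ℕd i q d = %ℕ-unique (i ℤ.+ q ℤ.* + d) (i /ℕ d ℤ.+ q) (n%ℕd<d i d) (begin
  i ℤ.+ q ℤ.* + d                               ≡⟨ cong (ℤ._+ q ℤ.* + d) (a≡a%ℕn+[a/ℕn]*n i d) ⟩
  + (i %ℕ d) ℤ.+ i /ℕ d ℤ.* + d ℤ.+ q ℤ.* + d  ≡⟨ collect (+ (i %ℕ d)) (i /ℕ d) q (+ d) ⟩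
  + (i %ℕ d) ℤ.+ (i /ℕ d ℤ.+ q) ℤ.* + d        ∎)
  where
  open ≡-Reasoning
  collect : ∀ r a b n → r ℤ.+ a ℤ.* n ℤ.+ b ℤ.* n ≡ r ℤ.+ (a ℤ.+ b) ℤ.* n
  collect = solve-∀

+[m+n]≡+n++m : ∀ m n → + (m + n) ≡ + n ℤ.+ + m
+[m+n]≡+n++m m n = trans (ℤ.pos-+ m n) (ℤ.+-comm (+ m) (+ n))

module _ {a} {A : Set a} where

  HasPeriod : (ℤ → A) → ℕ → Set a
  HasPeriod f p = ∀ i → f i ≡ f (i ℤ.+ + p)

  hasPeriod-∣ : ∀ {f p q} → HasPeriod f p → p ∣ q → HasPeriod f q
  hasPeriod-∣ {f} {p} f-p (divides c refl) = multiple c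
    where
    open ≡-Reasoning
    multiple : ∀ c → HasPeriod f (c * p)
    multiple zero    i = cong f (sym (ℤ.+-identityʳ i))
    multiple (suc c) i = begin
      f i                            ≡⟨ f-p i ⟩
      f (i ℤ.+ + p)                  ≡⟨ multiple c (i ℤ.+ + p) ⟩
      f (i ℤ.+ + p ℤ.+ + (c * p))    ≡⟨ cong f (ℤ.+-assoc i (+ p) (+ (c * p))) ⟩
      f (i ℤ.+ (+ p ℤ.+ + (c * p)))  ≡⟨ cong (λ j → f (i ℤ.+ j)) (ℤ.pos-+ p (c * p)) ⟨
      f (i ℤ.+ + (suc c * p))        ∎

  hasPeriod-cancelʳ : ∀ {f} p q → HasPeriod f q → HasPeriod f (p + q) → HasPeriod f p
  hasPeriod-cancelʳ {f} p q f-q f-p+q i = begin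
    f i                      ≡⟨ f-p+q i ⟩
    f (i ℤ.+ + (p + q))      ≡⟨ cong (λ j → f (i ℤ.+ j)) (ℤ.pos-+ p q) ⟩
    f (i ℤ.+ (+ p ℤ.+ + q))  ≡⟨ cong f (ℤ.+-assoc i (+ p) (+ q)) ⟨
    f (i ℤ.+ + p ℤ.+ + q)    ≡⟨ f-q (i ℤ.+ + p) ⟨
    f (i ℤ.+ + p)            ∎
    where open ≡-Reasoning

  hasPeriod-gcd : ∀ {f m n} → HasPeriod f m → HasPeriod f n → HasPeriod f (gcd m n)
  hasPeriod-gcd {f} {m} {n} f-m f-n with Bézout.identity (gcd-GCD m n)
  ... | Bézout.+- x y g+yn≡xm = hasPeriod-cancelʳ (gcd m n) (y * n)
          (hasPeriod-∣ f-n (divides y refl)) (hasPeriod-∣ f-m (divides x g+yn≡xm))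
  ... | Bézout.-+ x y g+xm≡yn = hasPeriod-cancelʳ (gcd m n) (x * m)
          (hasPeriod-∣ f-m (divides x refl)) (hasPeriod-∣ f-n (divides y g+xm≡yn))

ext[i+q*n]≡ext[i] : ∀ {n} .{{_ : NonZero n}} (u : Fin n → Bool) i q →
                    ext n u (i ℤ.+ q ℤ.* + n) ≡ ext n u i
ext[i+q*n]≡ext[i] {suc n} u i q = cong u (fromℕ<-cong _ _ ([i+q*d]%ℕd≡i%ℕd i q (suc n)) _ _)

ext-agrees : ∀ {n} (u : Fin n → Bool) (v : ℕ → Bool) → (∀ j → v (toℕ j) ≡ u j) →
             ∀ m → m < n → ext n u (+ m) ≡ v m
ext-agrees {suc n} u v v≈u m m<n = begin
  ext (suc n) u (+ m)   ≡⟨ cong u (fromℕ<-cong _ _ (m<n⇒m%n≡m m<n) _ m<n) ⟩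
  u (fromℕ< m<n)        ≡⟨ v≈u (fromℕ< m<n) ⟨
  v (toℕ (fromℕ< m<n))  ≡⟨ cong v (toℕ-fromℕ< m<n) ⟩
  v m                   ∎
  where open ≡-Reasoning

ext-hasPeriod : ∀ {n} .{{_ : NonZero n}} (u : Fin n → Bool) k →
                (∀ r → r < n → ext n u (+ r) ≡ ext n u (+ r ℤ.+ + k)) → HasPeriod (ext n u) k
ext-hasPeriod {n} u k window i = begin
  ext n u i                            ≡⟨ cong (ext n u) i≡r+qn ⟩
  ext n u (+ r ℤ.+ q ℤ.* + n)          ≡⟨ ext[i+q*n]≡ext[i] u (+ r) q ⟩
  ext n u (+ r)                        ≡⟨ window r (n%ℕd<d i n) ⟩
  ext n u (+ r ℤ.+ + k)                ≡⟨ ext[i+q*n]≡ext[i] u (+ r ℤ.+ + k) q ⟨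
  ext n u (+ r ℤ.+ + k ℤ.+ q ℤ.* + n)  ≡⟨ cong (ext n u) (swap (+ r) (+ k) (q ℤ.* + n)) ⟩
  ext n u (+ r ℤ.+ q ℤ.* + n ℤ.+ + k)  ≡⟨ cong (λ j → ext n u (j ℤ.+ + k)) i≡r+qn ⟨
  ext n u (i ℤ.+ + k)                  ∎
  where
  open ≡-Reasoning
  r = i %ℕ n
  q = i /ℕ n
  i≡r+qn : i ≡ + r ℤ.+ q ℤ.* + n
  i≡r+qn = a≡a%ℕn+[a/ℕn]*n i n
  swap : ∀ x y z → x ℤ.+ y ℤ.+ z ≡ x ℤ.+ z ℤ.+ y
  swap = solve-∀

-- Rotation of the cyclic word by a moves the first b letters up by a and wraps the last
-- a letters around to the front.
ext-hasPeriod-rotation : ∀ {n} .{{_ : NonZero n}} (u : Fin n → Bool) (v : ℕ → Bool) →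
  (∀ j → v (toℕ j) ≡ u j) → ∀ a b → a + b ≡ n →
  (∀ r → r < b → v (a + r) ≡ v r) → (∀ s → s < a → v (b + s) ≡ v s) →
  HasPeriod (ext n u) a
ext-hasPeriod-rotation {n} u v v≈u a b refl a-shift b-shift = ext-hasPeriod u a window
  where
  open ≡-Reasoning
  ũ≈v = ext-agrees u v v≈u
  window : ∀ r → r < n → ext n u (+ r) ≡ ext n u (+ r ℤ.+ + a)
  window r r<n with r <? b
  ... | yes r<b = begin
    ext n u (+ r)          ≡⟨ ũ≈v r r<n ⟩
    v r                    ≡⟨ a-shift r r<b ⟨
    v (a + r)              ≡⟨ ũ≈v (a + r) (ℕ.+-monoʳ-< a r<b) ⟨
    ext n u (+ (a + r))    ≡⟨ cong (ext n u) (+[m+n]≡+n++m a r) ⟩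
    ext n u (+ r ℤ.+ + a)  ∎
  ... | no r≮b with s , refl ← ℕ.m≤n⇒∃[o]m+o≡n (ℕ.≮⇒≥ r≮b) = begin
    ext n u (+ (b + s))             ≡⟨ ũ≈v (b + s) r<n ⟩
    v (b + s)                       ≡⟨ b-shift s s<a ⟩
    v s                             ≡⟨ ũ≈v s (ℕ.<-≤-trans s<a (ℕ.m≤m+n a b)) ⟨
    ext n u (+ s)                   ≡⟨ ext[i+q*n]≡ext[i] u (+ s) ℤ.1ℤ ⟨
    ext n u (+ s ℤ.+ ℤ.1ℤ ℤ.* + n)  ≡⟨ cong (ext n u) wrap ⟩
    ext n u (+ (b + s) ℤ.+ + a)     ∎
    where
    s<a : s < a
    s<a = ℕ.+-cancelˡ-< b s a (subst (b + s ℕ.<_) (ℕ.+-comm a b) r<n)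
    wrap : + s ℤ.+ ℤ.1ℤ ℤ.* + n ≡ + (b + s) ℤ.+ + a
    wrap = begin
      + s ℤ.+ ℤ.1ℤ ℤ.* + (a + b)      ≡⟨ cong (λ x → + s ℤ.+ ℤ.1ℤ ℤ.* x) (ℤ.pos-+ a b) ⟩
      + s ℤ.+ ℤ.1ℤ ℤ.* (+ a ℤ.+ + b)  ≡⟨ rotate (+ s) (+ a) (+ b) ⟩
      + b ℤ.+ + s ℤ.+ + a             ≡⟨ cong (ℤ._+ + a) (ℤ.pos-+ b s) ⟨
      + (b + s) ℤ.+ + a               ∎
      where
      rotate : ∀ x y z → x ℤ.+ ℤ.1ℤ ℤ.* (y ℤ.+ z) ≡ z ℤ.+ x ℤ.+ y
      rotate = solve-∀

ext-hasPeriod⇒shift-invariant : ∀ {n} (u : Fin n → Bool) (v : ℕ → Bool) →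
  (∀ j → v (toℕ j) ≡ u j) → ∀ a → HasPeriod (ext n u) a →
  ∀ r → a + r < n → v (a + r) ≡ v r
ext-hasPeriod⇒shift-invariant {n} u v v≈u a a-period r a+r<n = begin
  v (a + r)              ≡⟨ ũ≈v (a + r) a+r<n ⟨
  ext n u (+ (a + r))    ≡⟨ cong (ext n u) (+[m+n]≡+n++m a r) ⟩
  ext n u (+ r ℤ.+ + a)  ≡⟨ a-period (+ r) ⟨
  ext n u (+ r)          ≡⟨ ũ≈v r (ℕ.≤-<-trans (ℕ.m≤n+m r a) a+r<n) ⟩
  v r                    ∎
  where
  open ≡-Reasoning
  ũ≈v = ext-agrees u v v≈u

sumℤ-cong : ∀ k {f g : Fin k → ℤ} → (∀ i → f i ≡ g i) → sumℤ k f ≡ sumℤ k g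
sumℤ-cong zero    f≗g = refl
sumℤ-cong (suc k) f≗g = cong₂ ℤ._+_ (f≗g Fin.zero) (sumℤ-cong k (λ i → f≗g (Fin.suc i)))

sumUpTo : ℕ → (ℕ → ℤ) → ℤ
sumUpTo k f = sumℤ k (λ i → f (toℕ i))

sumUpTo-split : ∀ a b f → sumUpTo (a + b) f ≡ sumUpTo a f ℤ.+ sumUpTo b (λ n → f (a + n))
sumUpTo-split zero    b f = sym (ℤ.+-identityˡ _)
sumUpTo-split (suc a) b f = trans (cong (λ s → f 0 ℤ.+ s) (sumUpTo-split a b (λ n → f (suc n))))
                                  (sym (ℤ.+-assoc (f 0) _ _))

sumUpTo-difference : ∀ k f g → sumUpTo k (λ n → f n ℤ.- g n) ≡ sumUpTo k f ℤ.- sumUpTo k g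
sumUpTo-difference zero    f g = refl
sumUpTo-difference (suc k) f g =
  trans (cong (λ s → f 0 ℤ.- g 0 ℤ.+ s) (sumUpTo-difference k (λ n → f (suc n)) (λ n → g (suc n))))
        (interchange (f 0) (g 0) _ _)
  where
  interchange : ∀ a b c d → a ℤ.- b ℤ.+ (c ℤ.- d) ≡ a ℤ.+ c ℤ.- (b ℤ.+ d)
  interchange = solve-∀

sumUpTo-nonneg : ∀ k f → (∀ n → 0ℤ ℤ.≤ f n) → 0ℤ ℤ.≤ sumUpTo k f
sumUpTo-nonneg zero    f f≥0 = ℤ.≤-refl
sumUpTo-nonneg (suc k) f f≥0 =
  ℤ.+-mono-≤ (f≥0 0) (sumUpTo-nonneg k (λ n → f (suc n)) (λ n → f≥0 (suc n)))

nonneg-+≡0 : ∀ {i j} → 0ℤ ℤ.≤ i → 0ℤ ℤ.≤ j → i ℤ.+ j ≡ 0ℤ → i ≡ 0ℤ × j ≡ 0ℤ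
nonneg-+≡0 {+ m} {+ n} (+≤+ _) (+≤+ _) m+n≡0 =
  cong +_ (ℕ.m+n≡0⇒m≡0 m (ℤ.+-injective m+n≡0)) , cong +_ (ℕ.m+n≡0⇒n≡0 m (ℤ.+-injective m+n≡0))

sumUpTo≡0⇔ : ∀ k f → (∀ n → 0ℤ ℤ.≤ f n) → sumUpTo k f ≡ 0ℤ ⇔ (∀ n → n < k → f n ≡ 0ℤ)
sumUpTo≡0⇔ k f f≥0 = mk⇔ (to k f f≥0) (from k f)
  where
  to : ∀ k f → (∀ n → 0ℤ ℤ.≤ f n) → sumUpTo k f ≡ 0ℤ → ∀ n → n < k → f n ≡ 0ℤ
  to (suc k) f f≥0 sum≡0 n n<k
    with f0≡0 , rest≡0 ← nonneg-+≡0 (f≥0 0) (sumUpTo-nonneg k (λ n → f (suc n)) (λ n → f≥0 (suc n))) sum≡0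
    with n
  ... | zero  = f0≡0
  ... | suc n = to k (λ n → f (suc n)) (λ n → f≥0 (suc n)) rest≡0 n (ℕ.≤-pred n<k)
  from : ∀ k f → (∀ n → n < k → f n ≡ 0ℤ) → sumUpTo k f ≡ 0ℤ
  from zero    f f≡0 = refl
  from (suc k) f f≡0 =
    cong₂ ℤ._+_ (f≡0 0 (ℕ.s≤s ℕ.z≤n)) (from k (λ n → f (suc n)) (λ n n<k → f≡0 (suc n) (ℕ.s≤s n<k)))

shiftDifference : (ℕ → ℤ) → ℕ → ℕ → ℤ
shiftDifference w a k = sumUpTo k (λ n → w (a + n) ℤ.- w n)

shiftDifference-comm : ∀ w a b → shiftDifference w a b ≡ shiftDifference w b a
shiftDifference-comm w a b = begin
  shiftDifference w a b            ≡⟨ telescope a b ⟩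
  W (a + b) ℤ.- W a ℤ.- W b        ≡⟨ cong (λ c → W c ℤ.- W a ℤ.- W b) (ℕ.+-comm a b) ⟩
  W (b + a) ℤ.- W a ℤ.- W b        ≡⟨ swap (W (b + a)) (W a) (W b) ⟩
  W (b + a) ℤ.- W b ℤ.- W a        ≡⟨ telescope b a ⟨
  shiftDifference w b a            ∎
  where
  open ≡-Reasoning
  W : ℕ → ℤ
  W k = sumUpTo k w
  swap : ∀ x y z → x ℤ.- y ℤ.- z ≡ x ℤ.- z ℤ.- y
  swap = solve-∀
  cancel : ∀ x y → y ≡ x ℤ.+ y ℤ.- x
  cancel = solve-∀
  telescope : ∀ a b → shiftDifference w a b ≡ W (a + b) ℤ.- W a ℤ.- W b
  telescope a b = begin
    shiftDifference w a b                                  ≡⟨ sumUpTo-difference b (λ n → w (a + n)) w ⟩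
    sumUpTo b (λ n → w (a + n)) ℤ.- W b                    ≡⟨ cong (ℤ._- W b) (cancel (W a) _) ⟩
    W a ℤ.+ sumUpTo b (λ n → w (a + n)) ℤ.- W a ℤ.- W b    ≡⟨ cong (λ x → x ℤ.- W a ℤ.- W b) (sumUpTo-split a b w) ⟨
    W (a + b) ℤ.- W a ℤ.- W b                              ∎

bitℤ-monotone : ∀ {a b} → (b ≡ true → a ≡ true) → 0ℤ ℤ.≤ bitℤ a ℤ.- bitℤ b
bitℤ-monotone {true}  {true}  b⇒a = +≤+ ℕ.z≤n
bitℤ-monotone {true}  {false} b⇒a = +≤+ ℕ.z≤n
bitℤ-monotone {false} {false} b⇒a = +≤+ ℕ.z≤n
bitℤ-monotone {false} {true}  b⇒a with () ← b⇒a refl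

bitℤ-difference≡0⇔≡ : ∀ a b → bitℤ a ℤ.- bitℤ b ≡ 0ℤ ⇔ a ≡ b
bitℤ-difference≡0⇔≡ a b = mk⇔ (to a b) (λ { refl → ℤ.+-inverseʳ (bitℤ a) })
  where
  to : ∀ a b → bitℤ a ℤ.- bitℤ b ≡ 0ℤ → a ≡ b
  to true  true  _ = refl
  to false false _ = refl
  to true  false ()
  to false true  ()

shiftDifference≡0⇔ : ∀ (Δ : ℕ → Bool) a k → (∀ n → Δ n ≡ true → Δ (n + a) ≡ true) →
  shiftDifference (bitℤ ∘ Δ) a k ≡ 0ℤ ⇔ (∀ n → n < k → Δ (a + n) ≡ Δ n)
shiftDifference≡0⇔ Δ a k closed = mk⇔
  (λ diff≡0 n n<k → Equivalence.to (bitℤ-difference≡0⇔≡ _ _) (Equivalence.to sum≡0⇔ diff≡0 n n<k))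
  (λ invariant → Equivalence.from sum≡0⇔
     (λ n n<k → Equivalence.from (bitℤ-difference≡0⇔≡ _ _) (invariant n n<k)))
  where
  sum≡0⇔ : shiftDifference (bitℤ ∘ Δ) a k ≡ 0ℤ ⇔
           (∀ n → n < k → bitℤ (Δ (a + n)) ℤ.- bitℤ (Δ n) ≡ 0ℤ)
  sum≡0⇔ = sumUpTo≡0⇔ k _ (λ n → bitℤ-monotone
    (λ Δn → subst (λ m → Δ m ≡ true) (ℕ.+-comm n a) (closed n Δn)))

lam≡shiftDifference : ∀ M N (u : Fin (N + M) → Bool) (Δ : ℕ → Bool) → (∀ j → Δ (toℕ j) ≡ u j) →
                      lam M N u ≡ shiftDifference (bitℤ ∘ Δ) N M
lam≡shiftDifference M N u Δ Δ≈u = sumℤ-cong M (λ i → cong₂ ℤ._-_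
  (cong bitℤ (trans (sym (Δ≈u (N ↑ʳ i))) (cong Δ (toℕ-↑ʳ N i))))
  (cong bitℤ (trans (sym (Δ≈u (inject≤ i _))) (cong Δ (toℕ-inject≤ i _)))))

mainTheorem4 : (M N : ℕ) → .{{_ : NonZero M}} → .{{_ : NonZero N}} →
    (u : Fin (N + M) → Bool) → Admissible M N u →
    (lam M N u ≡ 0ℤ ⇔ ∃ λ (p : ℕ) → p ∣ gcd M N × Periodic M N p u)
-- Matching N as a successor makes N + M one too, which supplies the NonZero instance
-- required by the lemmas about ext.
mainTheorem4 M N@(suc _) u (Δ , (+N-closed , +M-closed , _) , Δ≈u) = mk⇔ periodic balanced
  where
  lam≡gain : lam M N u ≡ shiftDifference (bitℤ ∘ Δ) N M
  lam≡gain = lam≡shiftDifference M N u Δ Δ≈u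

  periodic : lam M N u ≡ 0ℤ → ∃ λ p → p ∣ gcd M N × Periodic M N p u
  periodic lam≡0 = gcd M N , ∣-refl , hasPeriod-gcd
      (ext-hasPeriod-rotation u Δ Δ≈u M N (ℕ.+-comm M N) M-invariant N-invariant)
      (ext-hasPeriod-rotation u Δ Δ≈u N M refl N-invariant M-invariant)
    where
    gain≡0 : shiftDifference (bitℤ ∘ Δ) N M ≡ 0ℤ
    gain≡0 = trans (sym lam≡gain) lam≡0
    N-invariant : ∀ n → n < M → Δ (N + n) ≡ Δ n
    N-invariant = Equivalence.to (shiftDifference≡0⇔ Δ N M +N-closed) gain≡0
    M-invariant : ∀ n → n < N → Δ (M + n) ≡ Δ n
    M-invariant = Equivalence.to (shiftDifference≡0⇔ Δ M N +M-closed)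
                    (trans (shiftDifference-comm (bitℤ ∘ Δ) M N) gain≡0)

  balanced : (∃ λ p → p ∣ gcd M N × Periodic M N p u) → lam M N u ≡ 0ℤ
  balanced (p , p∣gcd , p-period) = trans lam≡gain (Equivalence.from (shiftDifference≡0⇔ Δ N M +N-closed)
      (λ n n<M → ext-hasPeriod⇒shift-invariant u Δ Δ≈u N N-period n (ℕ.+-monoʳ-< N n<M)))
    where
    N-period : HasPeriod (ext (N + M) u) N
    N-period = hasPeriod-∣ p-period (∣-trans p∣gcd (gcd[m,n]∣n M N))
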